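{- For every positive integer $r$ and every graph $G$, if $\widetilde G$ denotes the graph obtained from $G$ by subdividing every edge $r$ times (replacing each edge by a path with $r$ internal vertices), then $\mathrm{cop}(\widetilde G)\le \mathrm{cop}(G)+1$.
   Context: All graphs are finite, simple and undirected. The game of Cops and Robber on a connected graph: the cop player places $k\ge 1$ cops on vertices (not necessarily distinct), then the robber chooses a vertex; then, starting with the cops, the players alternate moves, where in the cops' move each cop either stays or moves to an adjacent vertex, and in the robber's move the robber either stays or moves to an adjacent vertex. The cops win if at some point a cop and the robber occupy the same vertex; both players have complete information. The cop number $\mathrm{cop}$ of a connected graph is the least $k$ such that $k$ cops have a winning strategy; for a disconnected graph it is the maximum cop number of its connected components. -}

module Defs where

open import Data.Nat using (ℕ; zero; suc; _≤_; _<_; _∸_)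
open import Data.Fin using (Fin; toℕ)
open import Data.Bool using (Bool; true; false)
open import Data.Sum using (_⊎_; inj₁; inj₂)
open import Data.Product using (Σ; ∃; _×_; _,_)
open import Relation.Nullary using (¬_)
open import Relation.Binary.PropositionalEquality using (_≡_)
open import Relation.Binary.Construct.Closure.ReflexiveTransitive using (Star)

-- Finite simple graphs: vertex set Fin n, symmetric irreflexive
-- Boolean adjacency (every finite simple graph is isomorphic to one).

record SimpleGraph (n : ℕ) : Set where
  field
    adj   : Fin n → Fin n → Bool
    sym   : ∀ i j → adj i j ≡ adj j i
    irrefl : ∀ i → adj i i ≡ false

record Graph : Set₁ where
  field
    V : Set
    E : V → V → Set

open Graph public

toGraph : ∀ {n} → SimpleGraph n → Graph
toGraph {n} G = record { V = Fin n ; E = λ i j → SimpleGraph.adj G i j ≡ true }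

-- Subdivision: every edge {i,j} (oriented i < j) is replaced by the path
-- i — (i,j,0) — (i,j,1) — … — (i,j,r-1) — j  with r internal vertices.

OEdge : ∀ {n} → SimpleGraph n → Set
OEdge {n} G = Σ (Fin n) λ i → Σ (Fin n) λ j → (toℕ i < toℕ j) × (SimpleGraph.adj G i j ≡ true)

SubV : ∀ {n} → ℕ → SimpleGraph n → Set
SubV {n} r G = Fin n ⊎ (OEdge G × Fin r)

data SubE₀ {n} (r : ℕ) (G : SimpleGraph n) : SubV r G → SubV r G → Set where
  first : ∀ i j (lt : toℕ i < toℕ j) (e : SimpleGraph.adj G i j ≡ true) (k : Fin r) →
          toℕ k ≡ 0 → SubE₀ r G (inj₁ i) (inj₂ ((i , j , lt , e) , k))
  last  : ∀ i j (lt : toℕ i < toℕ j) (e : SimpleGraph.adj G i j ≡ true) (k : Fin r) →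
          toℕ k ≡ r ∸ 1 → SubE₀ r G (inj₂ ((i , j , lt , e) , k)) (inj₁ j)
  inner : ∀ (x : OEdge G) (k k' : Fin r) →
          toℕ k' ≡ suc (toℕ k) → SubE₀ r G (inj₂ (x , k)) (inj₂ (x , k'))

SubE : ∀ {n} (r : ℕ) (G : SimpleGraph n) → SubV r G → SubV r G → Set
SubE r G u v = SubE₀ r G u v ⊎ SubE₀ r G v u

subdivide : ∀ {n} → ℕ → SimpleGraph n → Graph
subdivide r G = record { V = SubV r G ; E = SubE r G }

module _ (H : Graph) where

  Step : V H → V H → Set
  Step u u' = (u ≡ u') ⊎ E H u u'

  CopsMove : ∀ {k} → (Fin k → V H) → (Fin k → V H) → Set
  CopsMove cs cs' = ∀ i → Step (cs i) (cs' i)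

  Caught : ∀ {k} → (Fin k → V H) → V H → Set
  Caught cs r = ∃ λ i → cs i ≡ r

  -- CopTurn cs r : cops at cs, robber at r, cops to move; the cops can
  -- force a capture in finitely many rounds.
  data CopTurn {k : ℕ} (cs : Fin k → V H) (r : V H) : Set where
    move : (cs' : Fin k → V H) → CopsMove cs cs' →
           (Caught cs' r ⊎ (∀ r' → Step r r' → Caught cs' r' ⊎ CopTurn cs' r')) →
           CopTurn cs r

  Reach : V H → V H → Set
  Reach = Star (E H)

  -- k cops win the game on the connected component of v: they choose
  -- initial positions, then the robber chooses any vertex of that component.
  WinsOnComponentOf : ℕ → V H → Set
  WinsOnComponentOf k v =
    ∃ λ (cs : Fin k → V H) → ∀ u → Reach v u → Caught cs u ⊎ CopTurn cs u

  CopsWin : ℕ → Set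
  CopsWin k = ∀ v → WinsOnComponentOf k v

  CopNumber : ℕ → Set
  CopNumber c = (1 ≤ c) × CopsWin c × (∀ k → 1 ≤ k → k < c → ¬ CopsWin k)

module Submission where

-- Let c cops win on G and let H be its subdivision, where each edge of G becomes a path
-- of length r + 1.  Besides c cops that shadow the G-strategy, H gets one chaser that walks
-- along the robber's trail.  The trail never gets longer, and it gets shorter whenever the
-- robber stays put or turns back; once it is empty the chaser catches the robber.  As long
-- as the trail keeps its length the robber runs along the subdivided paths without turning,
-- so it behaves like a robber of G moving once every r + 1 rounds, and the shadowing cops,
-- starting a move of G whenever the robber leaves a branch vertex, catch it.  Each time the
-- trail shrinks the shadowing cops walk back to their starting vertices and begin afresh.

open import Defs
open import Data.Nat using (ℕ; zero; suc; _≤_; _<_; _∸_; _+_; z≤n; s≤s; _<?_)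
open import Data.Nat.Properties
  using (≤-refl; <⇒≤; ≤-pred; m≤n+m; m∸n≤m; n∸n≡0; m∸n+n≡m; m∸[m∸n]≡n;
         +-∸-assoc; +-suc; +-identityʳ; <-irrelevant; <-cmp; n≮n; ≮⇒≥; m≤n⇒m<n∨m≡n)
open import Data.Fin as Fin using (Fin; toℕ; fromℕ<)
open import Data.Fin.Properties using (toℕ<n; toℕ-fromℕ<; fromℕ<-toℕ; toℕ-injective)
open import Data.Vec.Functional using (_∷_)
open import Data.Bool using (Bool; true; false)
import Data.Bool as Bool
open import Data.Sum using (_⊎_; inj₁; inj₂; swap)
import Data.Sum as Sum
import Data.Sum.Properties as Sum
import Data.Product.Properties as Product
open import Data.Product using (∃; ∃₂; _×_; _,_; proj₁; proj₂)
open import Data.Empty using (⊥-elim)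
open import Function using (_∘′_; id)
open import Relation.Nullary using (yes; no)
open import Relation.Binary.Definitions using (DecidableEquality; tri<; tri≈; tri>)
open import Relation.Binary.PropositionalEquality
open import Relation.Binary.Construct.Closure.ReflexiveTransitive
  using (Star; ε; _◅_; _◅◅_; return; reverse; kleisliStar)
open import Axiom.UniquenessOfIdentityProofs using (module Decidable⇒UIP)

stay : ∀ H {k} {cs : Fin k → V H} → CopsMove H cs cs
stay _ _ = inj₁ refl

module Chase (H : Graph) (_≟_ : DecidableEquality (V H)) (root : V H) where

  data Walk : V H → V H → ℕ → Set where
    []  : ∀ {x} → Walk x x 0
    _◅_ : ∀ {x y z m} → E H x y → Walk y z m → Walk x z (suc m)

  snoc : ∀ {x y z m} → Walk x y m → E H y z → Walk x z (suc m)
  snoc []       e = e ◅ []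
  snoc (f ◅ w) e = f ◅ snoc w e

  unsnoc : ∀ {x z m} → Walk x z (suc m) → ∃ λ y → Walk x y m × E H y z
  unsnoc (e ◅ [])     = _ , [] , e
  unsnoc (e ◅ f ◅ w) with unsnoc (f ◅ w)
  ... | y , w′ , g = y , e ◅ w′ , g

  walk : ∀ {x y} → Star (E H) x y → ∃ (Walk x y)
  walk ε       = 0 , []
  walk (e ◅ p) = suc (proj₁ (walk p)) , e ◅ proj₂ (walk p)

  -- The chaser stands at e and the robber has just moved from p to x.
  record Pursuit (M : ℕ) (e p x : V H) : Set where
    constructor pursuit
    field
      {length}  : ℕ
      bounded   : length ≤ M
      trail     : Walk e p length
      last-move : E H p x
      reachable : Reach H root x

  open Pursuit public

  _∷ᵐ_ : ∀ {k e e′} {cs cs′ : Fin k → V H} →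
         Step H e e′ → CopsMove H cs cs′ → CopsMove H (e ∷ cs) (e′ ∷ cs′)
  (st ∷ᵐ mv) Fin.zero    = st
  (st ∷ᵐ mv) (Fin.suc i) = mv i

  capture : ∀ {k e x} {cs cs′ : Fin k → V H} → E H e x → CopsMove H cs cs′ → CopTurn H (e ∷ cs) x
  capture ex mv = move _ (inj₂ ex ∷ᵐ mv) (inj₁ (Fin.zero , refl))

  relocate : ∀ {M k e p p′ x x′} {cs : Fin k → V H} → p ≡ p′ → x ≡ x′ →
             (Pursuit M e p′ x′ → CopTurn H (e ∷ cs) x′) → Pursuit M e p x → CopTurn H (e ∷ cs) x
  relocate refl refl play = play

  pursuit-start : ∀ {u} → Reach H root u → root ≡ u ⊎ ∃₂ λ M p → Pursuit M root p u
  pursuit-start ε = inj₁ refl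
  pursuit-start path@(e ◅ p) with unsnoc (e ◅ proj₂ (walk p))
  ... | y , w , g = inj₂ (_ , y , pursuit ≤-refl w g path)

  chase : ∀ {M k e p x} {cs cs′ : Fin k → V H} →
          Pursuit (suc M) e p x → CopsMove H cs cs′ →
          (∀ {e′ p′ x′} → Pursuit M e′ p′ x′ → CopTurn H (e′ ∷ cs′) x′) →
          (∀ {e′ x′} → Pursuit (suc M) e′ x x′ → x′ ≢ p → CopTurn H (e′ ∷ cs′) x′) →
          CopTurn H (e ∷ cs) x
  chase (pursuit _ [] px _) mv _ _ = capture px mv
  chase {M} {p = p} {x} {cs′ = cs′} (pursuit (s≤s m≤M) (first-edge ◅ tr) px reach) mv shorter onward =
    move _ (inj₂ first-edge ∷ᵐ mv) (inj₂ reply)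
    where
    back : ∀ {e₁ m} → m ≤ M → Walk e₁ p m → Reach H root p →
           Caught H (e₁ ∷ cs′) p ⊎ CopTurn H (e₁ ∷ cs′) p
    back _   []        _      = inj₁ (Fin.zero , refl)
    back m≤M w@(_ ◅ _) reachp with unsnoc w
    ... | _ , w′ , g = inj₂ (shorter (pursuit (<⇒≤ m≤M) w′ g reachp))

    reply : ∀ x′ → Step H x x′ → Caught H (_ ∷ cs′) x′ ⊎ CopTurn H (_ ∷ cs′) x′
    reply _  (inj₁ refl) = inj₂ (shorter (pursuit m≤M tr px reach))
    reply x′ (inj₂ xx′) with x′ ≟ p
    ... | yes refl = back m≤M tr (reach ◅◅ return xx′)
    ... | no x′≢p  = inj₂ (onward (pursuit (s≤s m≤M) (snoc tr px) xx′ (reach ◅◅ return xx′)) x′≢p)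

module Subdivision {n} (G : SimpleGraph n) (r₀ : ℕ) where

  r : ℕ
  r = suc r₀

  H : Graph
  H = subdivide r G

  Gᵍ : Graph
  Gᵍ = toGraph G

  V′ : Set
  V′ = SubV r G

  _~_ : V′ → V′ → Set
  _~_ = SubE r G

  Adj : Fin n → Fin n → Set
  Adj = E Gᵍ

  Adj-sym : ∀ {a b} → Adj a b → Adj b a
  Adj-sym {a} {b} ab = trans (SimpleGraph.sym G b a) ab

  step-sym : ∀ {x y} → Step H x y → Step H y x
  step-sym = Sum.map sym swap

  moves-sym : ∀ {k} {cs cs′ : Fin k → V′} → CopsMove H cs cs′ → CopsMove H cs′ cs
  moves-sym mv i = step-sym (mv i)

  -- The vertex at distance t from i on the path replacing e = (i , j); it is j for every t > r.
  pos : OEdge G → ℕ → V′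
  pos (i , _) zero = inj₁ i
  pos e@(_ , j , _) (suc t) with t <? r
  ... | yes t<r = inj₂ (e , fromℕ< t<r)
  ... | no _    = inj₁ j

  pos-inner : ∀ e {t} (t<r : t < r) → pos e (suc t) ≡ inj₂ (e , fromℕ< t<r)
  pos-inner e {t} t<r with t <? r
  ... | yes _   = refl
  ... | no  t≮r = ⊥-elim (t≮r t<r)

  pos-at : ∀ e (k : Fin r) {t} → toℕ k ≡ t → pos e (suc t) ≡ inj₂ (e , k)
  pos-at e k refl = trans (pos-inner e (toℕ<n k)) (cong (λ k → inj₂ (e , k)) (fromℕ<-toℕ k _))

  pos-end : ∀ e → pos e (suc r) ≡ inj₁ (proj₁ (proj₂ e))
  pos-end e with r <? r
  ... | yes r<r = ⊥-elim (n≮n r r<r)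
  ... | no _    = refl

  pos-step : ∀ e {t} → t ≤ r → SubE₀ r G (pos e t) (pos e (suc t))
  pos-step e@(i , j , lt , ij) {zero} _ =
    subst (SubE₀ r G (inj₁ i)) (sym (pos-at e Fin.zero refl)) (first i j lt ij Fin.zero refl)
  pos-step e@(i , j , lt , ij) {suc t} t<r with m≤n⇒m<n∨m≡n t<r
  ... | inj₁ t+1<r =
    subst₂ (SubE₀ r G) (sym (pos-at e k (toℕ-fromℕ< t<r))) (sym (pos-at e k′ (toℕ-fromℕ< t+1<r)))
      (inner e k k′ (trans (toℕ-fromℕ< t+1<r) (cong suc (sym (toℕ-fromℕ< t<r)))))
    where
    k k′ : Fin r
    k  = fromℕ< t<r
    k′ = fromℕ< t+1<r
  ... | inj₂ refl =
    subst₂ (SubE₀ r G) (sym (pos-at e k (toℕ-fromℕ< t<r))) (sym (pos-end e))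
      (last i j lt ij k (toℕ-fromℕ< t<r))
    where
    k : Fin r
    k = fromℕ< t<r

  inner-neighbours : ∀ e (k : Fin r) {y} → inj₂ (e , k) ~ y →
                     y ≡ pos e (toℕ k) ⊎ y ≡ pos e (suc (suc (toℕ k)))
  inner-neighbours e k (inj₁ (last _ _ _ _ _ eq)) =
    inj₂ (sym (trans (cong (λ t → pos e (suc (suc t))) eq) (pos-end e)))
  inner-neighbours e k (inj₁ (inner _ _ k′ eq)) =
    inj₂ (sym (pos-at e k′ eq))
  inner-neighbours e k (inj₂ (first _ _ _ _ _ eq)) =
    inj₁ (cong (pos e) (sym eq))
  inner-neighbours e k (inj₂ (inner _ k″ _ eq)) =
    inj₁ (sym (trans (cong (pos e) eq) (pos-at e k″ refl)))

  pos-neighbours : ∀ e {u} → u < r → ∀ {y} → pos e (suc u) ~ y →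
                   y ≡ pos e u ⊎ y ≡ pos e (suc (suc u))
  pos-neighbours e u<r xy =
    Sum.map (λ y≡ → trans y≡ (cong (pos e) k≡u)) (λ y≡ → trans y≡ (cong (λ t → pos e (suc (suc t))) k≡u))
      (inner-neighbours e _ (subst (_~ _) (pos-inner e u<r) xy))
    where
    k≡u : toℕ (fromℕ< u<r) ≡ _
    k≡u = toℕ-fromℕ< u<r

  pos-edge : ∀ {x y} → SubE₀ r G x y → ∃₂ λ e t → t ≤ r × pos e t ≡ x × pos e (suc t) ≡ y
  pos-edge (first i j lt ij k eq) = (i , j , lt , ij) , 0 , z≤n , refl , pos-at _ k eq
  pos-edge (last i j lt ij k eq)  = (i , j , lt , ij) , r , ≤-refl , pos-at _ k eq , pos-end _
  pos-edge (inner e k k′ eq)      = e , suc (toℕ k) , toℕ<n k , pos-at e k refl , pos-at e k′ eq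

  -- A dart is an edge of G with a direction: true runs from the smaller end to the larger.
  Dart : Set
  Dart = OEdge G × Bool

  start end : Dart → Fin n
  start ((i , _) , true)     = i
  start ((_ , j , _) , false) = j
  end ((_ , j , _) , true)   = j
  end ((i , _) , false)      = i

  dart-adj : ∀ d → Adj (start d) (end d)
  dart-adj ((_ , _ , _ , ij) , true)  = ij
  dart-adj ((_ , _ , _ , ij) , false) = Adj-sym ij

  point : Dart → ℕ → V′
  point (e , true)  t = pos e t
  point (e , false) t = pos e (suc r ∸ t)

  suc-∸ : ∀ {m t} → t ≤ m → suc m ∸ t ≡ suc (m ∸ t)
  suc-∸ = +-∸-assoc 1

  point-start : ∀ d → point d 0 ≡ inj₁ (start d)
  point-start (e , true)  = refl
  point-start (e , false) = pos-end e

  point-end : ∀ d → point d (suc r) ≡ inj₁ (end d)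
  point-end (e , true)  = pos-end e
  point-end (e , false) = cong (pos e) (n∸n≡0 (suc r))

  point-step : ∀ d {t} → t < suc r → point d t ~ point d (suc t)
  point-step (e , true)  t<r+1 = inj₁ (pos-step e (≤-pred t<r+1))
  point-step (e , false) {t} t<r+1 =
    inj₂ (subst (SubE₀ r G _) (cong (pos e) (sym (suc-∸ (≤-pred t<r+1)))) (pos-step e (m∸n≤m r t)))

  point-neighbours : ∀ d {t} → t < r → ∀ {y} → point d (suc t) ~ y →
                     y ≡ point d t ⊎ y ≡ point d (suc (suc t))
  point-neighbours (e , true)  t<r xy = pos-neighbours e t<r xy
  point-neighbours (e , false) {t} t<r xy =
    Sum.swap (Sum.map₂ (λ y≡ → trans y≡ (cong (pos e) (sym r+1∸t≡)))
               (pos-neighbours e (s≤s (m∸n≤m r₀ t)) (subst (_~ _) (cong (pos e) r∸t≡) xy)))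
    where
    r∸t≡ : r ∸ t ≡ suc (r₀ ∸ t)
    r∸t≡ = suc-∸ (≤-pred t<r)

    r+1∸t≡ : suc r ∸ t ≡ suc (suc (r₀ ∸ t))
    r+1∸t≡ = trans (suc-∸ (<⇒≤ t<r)) (cong suc r∸t≡)

  onward : ∀ d {t} → t < r → ∀ {y} → point d (suc t) ~ y → y ≢ point d t → y ≡ point d (suc (suc t))
  onward d t<r xy y≢ = Sum.[ ⊥-elim ∘′ y≢ , id ]′ (point-neighbours d t<r xy)

  edge-on-dart : ∀ {x y} → x ~ y → ∃₂ λ d t → t ≤ r × x ≡ point d t × y ≡ point d (suc t)
  edge-on-dart (inj₁ xy) with pos-edge xy
  ... | e , t , t≤r , x≡ , y≡ = (e , true) , t , t≤r , sym x≡ , sym y≡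
  edge-on-dart (inj₂ yx) with pos-edge yx
  ... | e , t , t≤r , y≡ , x≡ =
    (e , false) , r ∸ t , m∸n≤m r t ,
    sym (trans (cong (pos e) (trans (suc-∸ (m∸n≤m r t)) (cong suc (m∸[m∸n]≡n t≤r)))) x≡) ,
    sym (trans (cong (pos e) (m∸[m∸n]≡n t≤r)) y≡)

  branch-neighbours : ∀ {b y} → inj₁ b ~ y → ∃ λ d → start d ≡ b × point d 1 ≡ y
  branch-neighbours (inj₁ (first i j lt ij k eq)) = ((i , j , lt , ij) , true) , refl , pos-at _ k eq
  branch-neighbours (inj₂ (last i j lt ij k eq))  = ((i , j , lt , ij) , false) , refl , pos-at _ k eq

  departure : ∀ d {y} → point d (suc r) ~ y →
              ∃ λ d′ → Adj (end d) (end d′) × point d (suc r) ≡ point d′ 0 × y ≡ point d′ 1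
  departure d xy with branch-neighbours (subst (_~ _) (point-end d) xy)
  ... | d′ , start≡ , y≡ =
    d′ , subst (λ a → Adj a (end d′)) start≡ (dart-adj d′) ,
    trans (point-end d) (trans (cong inj₁ (sym start≡)) (sym (point-start d′))) , sym y≡

  base : V′ → Fin n
  base (inj₁ a)              = a
  base (inj₂ ((i , _) , _)) = i

  base-edge₀ : ∀ {x y} → SubE₀ r G x y → Star Adj (base x) (base y)
  base-edge₀ (first _ _ _ _ _ _)  = ε
  base-edge₀ (last _ _ _ ij _ _)  = return ij
  base-edge₀ (inner _ _ _ _)      = ε

  base-reach : ∀ {x y} → Reach H x y → Reach Gᵍ (base x) (base y)
  base-reach = kleisliStar base (Sum.[ base-edge₀ , reverse Adj-sym ∘′ base-edge₀ ]′)

  reach-end : ∀ {u} d → Reach H u (point d 1) → Reach Gᵍ (base u) (end d)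
  reach-end {u} d path =
    subst (Reach Gᵍ (base u)) (cong base (point-start d))
      (base-reach (path ◅◅ return (swap (point-step d (s≤s z≤n)))))
    ◅◅ return (dart-adj d)

  dart-of : ∀ {a b} → Adj a b → ∃ λ d → start d ≡ a × end d ≡ b
  dart-of {a} {b} ab with <-cmp (toℕ a) (toℕ b)
  ... | tri< a<b _ _ = ((a , b , a<b , ab) , true) , refl , refl
  ... | tri> _ _ b<a = ((b , a , b<a , Adj-sym ab) , false) , refl , refl
  ... | tri≈ _ a≡b _ with toℕ-injective a≡b
  ...   | refl with trans (sym ab) (SimpleGraph.irrefl G a)
  ...     | ()

  -- The position, s steps in, of a cop of H shadowing one move of a cop of G.
  track : ∀ {a b} → Step Gᵍ a b → ℕ → V′
  track {a} _ zero           = inj₁ a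
  track {a} (inj₁ _) (suc _) = inj₁ a
  track (inj₂ ab) (suc s)    = point (proj₁ (dart-of ab)) (suc s)

  track-step : ∀ {a b} (st : Step Gᵍ a b) {s} → s < suc r → Step H (track st s) (track st (suc s))
  track-step (inj₁ _) {zero}  _ = inj₁ refl
  track-step (inj₁ _) {suc _} _ = inj₁ refl
  track-step (inj₂ ab) {suc s} s<r+1 = inj₂ (point-step (proj₁ (dart-of ab)) s<r+1)
  track-step (inj₂ ab) {zero}  _ with dart-of ab
  ... | d , refl , _ = inj₂ (subst (_~ point d 1) (point-start d) (point-step d (s≤s z≤n)))

  track-arrive : ∀ {a b} (st : Step Gᵍ a b) → Step H (track st r) (inj₁ b)
  track-arrive (inj₁ refl) = track-step (inj₁ refl) ≤-refl
  track-arrive (inj₂ ab) with dart-of ab | track-step (inj₂ ab) {r} ≤-refl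
  ... | d , _ , refl | st = subst (Step H _) (point-end d) st

  _≟ᵥ_ : DecidableEquality V′
  _≟ᵥ_ = Sum.≡-dec Fin._≟_ (Product.≡-dec edge-≟ Fin._≟_)
    where
    edge-≟ : DecidableEquality (OEdge G)
    edge-≟ = Product.≡-dec Fin._≟_ (Product.≡-dec Fin._≟_ λ _ _ →
               yes (cong₂ _,_ (<-irrelevant _ _) (Decidable⇒UIP.≡-irrelevant Bool._≟_ _ _)))

  module Strategy {c} (v : V′) (winᴳ : WinsOnComponentOf Gᵍ c (base v)) where

    open Chase H _≟ᵥ_ v

    home : Fin c → V′
    home i = inj₁ (proj₁ winᴳ i)

    Homeward : (Fin c → V′) → Set
    Homeward cs = Star (CopsMove H) cs home

    Restart : ℕ → Set
    Restart M = ∀ {e p x cs} → Pursuit M e p x → Homeward cs → CopTurn H (e ∷ cs) x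

    AfterMove : (Fin c → Fin n) → Fin n → Set
    AfterMove C f = Caught Gᵍ C f ⊎ (∀ f′ → Step Gᵍ f f′ → Caught Gᵍ C f′ ⊎ CopTurn Gᵍ C f′)

    shadow : ∀ {C C′ : Fin c → Fin n} → CopsMove Gᵍ C C′ → ℕ → Fin c → V′
    shadow cm s i = track (cm i) s

    1+k+s≡r⇒s<r : ∀ k {s} → suc k + s ≡ r → s < r
    1+k+s≡r⇒s<r k {s} eq = subst (s <_) eq (s≤s (m≤n+m s k))

    module Phases (M : ℕ) (retreat : Restart M) where

      turn : ∀ {e p x} {cs cs′ : Fin c → V′} → Pursuit (suc M) e p x → CopsMove H cs cs′ → Homeward cs′ →
             (∀ {e′ x′} → Pursuit (suc M) e′ x x′ → x′ ≢ p → CopTurn H (e′ ∷ cs′) x′) →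
             CopTurn H (e ∷ cs) x
      turn π mv home-path = chase π mv (λ π′ → retreat π′ home-path)

      mutual
        run : ∀ {e} {C C′ : Fin c → Fin n} (cm : CopsMove Gᵍ C C′) d → AfterMove C′ (end d) →
              ∀ k {s} → k + s ≡ r → Pursuit (suc M) e (point d s) (point d (suc s)) →
              Homeward (shadow cm s) → CopTurn H (e ∷ shadow cm s) (point d (suc s))
        run cm d outcome (suc k) {s} eq π home-path =
          turn π advance (moves-sym advance ◅ home-path) λ π′ x′≢ →
            relocate refl (onward d (1+k+s≡r⇒s<r k eq) (last-move π′) x′≢)
              (λ π″ → run cm d outcome k (trans (+-suc k s) eq) π″ (moves-sym advance ◅ home-path)) π′
          where
          advance : CopsMove H (shadow cm s) (shadow cm (suc s))
          advance i = track-step (cm i) (s≤s (<⇒≤ (1+k+s≡r⇒s<r k eq)))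
        run cm d (inj₁ (i , C′i≡)) zero refl π home-path =
          move _ (inj₁ refl ∷ᵐ (λ i → track-arrive (cm i)))
            (inj₁ (Fin.suc i , trans (cong inj₁ C′i≡) (sym (point-end d))))
        run cm d (inj₂ next) zero refl π home-path =
          turn π arrive (moves-sym arrive ◅ home-path) λ π′ _ →
            let (d′ , step , at-start , at-1) = departure d (last-move π′) in
            relocate at-start at-1
              (λ π″ → resume d′ (next (end d′) (inj₂ step)) π″ (moves-sym arrive ◅ home-path)) π′
          where
          arrive : CopsMove H (shadow cm r) (λ i → inj₁ _)
          arrive i = track-arrive (cm i)

        resume : ∀ {e} {C : Fin c → Fin n} d → Caught Gᵍ C (end d) ⊎ CopTurn Gᵍ C (end d) →
                 Pursuit (suc M) e (point d 0) (point d 1) →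
                 Homeward (λ i → inj₁ (C i)) → CopTurn H (e ∷ λ i → inj₁ (C i)) (point d 1)
        resume d (inj₁ caught)              = run (stay Gᵍ) d (inj₁ caught) r (+-identityʳ r)
        resume d (inj₂ (move _ cm outcome)) = run cm d outcome r (+-identityʳ r)

      -- The robber has just left start d, so it reaches end d after r more moves, exactly
      -- when the shadowing cops complete a move of G against a robber standing at end d.
      align : ∀ {e} d → Pursuit (suc M) e (point d 0) (point d 1) → CopTurn H (e ∷ home) (point d 1)
      align d π = resume d (proj₂ winᴳ (end d) (reach-end d (reachable π))) π ε

      wait : ∀ {e} d k {t} → k + t ≡ r → Pursuit (suc M) e (point d t) (point d (suc t)) →
             CopTurn H (e ∷ home) (point d (suc t))
      wait d k {zero} _ π = align d π
      wait d (suc k) {suc t} eq π =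
        turn π (stay H) ε λ π′ x′≢ →
          relocate refl (onward d (1+k+s≡r⇒s<r k eq) (last-move π′) x′≢)
            (wait d k (trans (+-suc k (suc t)) eq)) π′
      wait d zero {suc t} refl π =
        turn π (stay H) ε λ π′ _ →
          let (d′ , _ , at-start , at-1) = departure d (last-move π′) in
          relocate at-start at-1 (align d′) π′

      walk-home : ∀ {e p x cs} → Pursuit (suc M) e p x → Homeward cs → CopTurn H (e ∷ cs) x
      walk-home π (mv ◅ home-path) = turn π mv home-path λ π′ _ → walk-home π′ home-path
      walk-home π ε =
        let (d , t , t≤r , at-t , at-t+1) = edge-on-dart (last-move π) in
        relocate at-t at-t+1 (wait d (r ∸ t) (m∸n+n≡m t≤r)) π

    restart : ∀ M → Restart M
    restart zero (pursuit _ [] px _) _ = capture px (stay H)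
    restart (suc M) = Phases.walk-home M (restart M)

    winning : WinsOnComponentOf H (suc c) v
    winning = v ∷ home , respond
      where
      respond : ∀ u → Reach H v u → Caught H (v ∷ home) u ⊎ CopTurn H (v ∷ home) u
      respond u path with pursuit-start path
      ... | inj₁ refl          = inj₁ (Fin.zero , refl)
      ... | inj₂ (M , _ , π) = inj₂ (restart M π ε)

  copsWin-subdivide : ∀ {c} → CopsWin Gᵍ c → CopsWin H (suc c)
  copsWin-subdivide winᴳ v = Strategy.winning v (winᴳ (base v))

proposition13 : ∀ (n : ℕ) (G : SimpleGraph n) (r : ℕ) → 1 ≤ r →
    ∀ (c c' : ℕ) → CopNumber (toGraph G) c → CopNumber (subdivide r G) c' →
    c' ≤ suc c
proposition13 n G (suc r₀) _ c c' (_ , winᴳ , _) (_ , _ , minimal) =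
  ≮⇒≥ λ c+1<c' → minimal (suc c) (s≤s z≤n) c+1<c' (Subdivision.copsWin-subdivide G r₀ winᴳ)
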